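{- Work set-theoretically. Let $T\mathbb{N}$ be the set of point-wise continuous functions $f\colon\mathbb{N}^{\mathbb{N}}\to\mathbb{N}$, with $\eta(n) := \lambda\alpha.n$, $\mathsf{KE}_{\mathbb{N}}(f)(g) := \lambda\alpha. f(g(\alpha))(\alpha)$ (for $f\colon\mathbb{N}\to T\mathbb{N}$, $g\in T\mathbb{N}$), $\mathsf{At}(n) := \lambda\alpha.\alpha(n)$, and $f\bullet\alpha := f(\alpha)$. Let $T\mathbb{N}'$ be the set of neighbourhood functions $\gamma\colon\mathbb{N}^*\to\mathbb{N}$, with $\eta'(n) := \lambda a. n+1$, $\mathsf{KE}'_{\mathbb{N}}(h)(\gamma) := \lambda a. \mathrm{sg}(\gamma(a))\cdot h(\gamma(a)\dot- 1)(a)$ (for $h\colon\mathbb{N}\to T\mathbb{N}'$, $\gamma\in T\mathbb{N}'$), $\mathsf{At}'(n) := \lambda a.\, (0$ if $|a|\le n$, and $a_n+1$ otherwise$)$, and $\gamma\bullet'\alpha := \gamma(\overline{\alpha}(\mu n.\gamma(\overline{\alpha}n)>0))\dot- 1$. Then: (1) for each $n\in\mathbb{N}$, $\eta'(n)$ and $\mathsf{At}'(n)$ are neighbourhood functions of $\eta(n)$ and $\mathsf{At}(n)$, respectively; (2) if $h\colon\mathbb{N}\to T\mathbb{N}'$ and $f\colon\mathbb{N}\to T\mathbb{N}$ are functions such that $h(n)$ is a neighbourhood function of $f(n)$ for each $n\in\mathbb{N}$, and if $\gamma$ is a neighbourhood function of $g$, then $\mathsf{KE}'_{\mathbb{N}}(h)(\gamma)$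 is a neighbourhood function of $\mathsf{KE}_{\mathbb{N}}(f)(g)$; (3) if $\gamma$ is a neighbourhood function of $f$, then $\gamma\bullet'\alpha = f\bullet\alpha$ for all $\alpha\in\mathbb{N}^{\mathbb{N}}$.
   Context: Finite sequences of naturals ($\mathbb{N}^*$) are coded as naturals; $|a|$ is the length, $a_n$ the $n$-th entry, $a*b$ concatenation, $\overline{\alpha}n$ the initial segment of $\alpha$ of length $n$, $\dot-$ cut-off subtraction, $\mathrm{sg}$ the signum function, $\cdot$ multiplication, $\mu n$ least-number search. A function $\gamma\colon\mathbb{N}^*\to\mathbb{N}$ is a neighbourhood function if (i) for every $\alpha$ there is $n$ with $\gamma(\overline{\alpha}n)>0$ and (ii) $\gamma(a)>0$ implies $\gamma(a*b)=\gamma(a)$ for all $b$. It is a neighbourhood function of $f\colon\mathbb{N}^{\mathbb{N}}\to\mathbb{N}$ if moreover $\gamma(\overline{\alpha}n)>0$ implies $f(\alpha)=\gamma(\overline{\alpha}n)\dot-1$ for all $\alpha,n$. -}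

module Defs where

open import Data.Nat using (ℕ; zero; suc; _+_; _*_; _∸_; _≤_; _<_; _≤?_; _>_)
open import Data.Nat.Properties using (≰⇒>)
open import Data.List using (List; []; _∷_; _++_; length; map; upTo; lookup)
open import Data.Fin using (fromℕ<)
open import Data.Product using (Σ; ∃; _×_; _,_; proj₁)
open import Relation.Binary.PropositionalEquality using (_≡_)
open import Relation.Nullary using (yes; no)

Baire : Set
Baire = ℕ → ℕ

Seq : Set
Seq = List ℕ

seg : Baire → ℕ → Seq
seg α n = map α (upTo n)

sg : ℕ → ℕ
sg zero    = 0
sg (suc _) = 1

Continuous : (Baire → ℕ) → Set
Continuous f = ∀ α → ∃ λ n → ∀ β → seg α n ≡ seg β n → f α ≡ f β

IsNF : (Seq → ℕ) → Set
IsNF γ = (∀ α → ∃ λ n → γ (seg α n) > 0)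
       × (∀ a b → γ a > 0 → γ (a ++ b) ≡ γ a)

IsNFOf : (Seq → ℕ) → (Baire → ℕ) → Set
IsNFOf γ f = IsNF γ × (∀ α n → γ (seg α n) > 0 → f α ≡ γ (seg α n) ∸ 1)

η : ℕ → Baire → ℕ
η n = λ α → n

KE : (ℕ → Baire → ℕ) → (Baire → ℕ) → Baire → ℕ
KE f g = λ α → f (g α) α

At : ℕ → Baire → ℕ
At n = λ α → α n

_•_ : (Baire → ℕ) → Baire → ℕ
f • α = f α

η′ : ℕ → Seq → ℕ
η′ n = λ a → n + 1

KE′ : (ℕ → Seq → ℕ) → (Seq → ℕ) → Seq → ℕ
KE′ h γ = λ a → sg (γ a) * h (γ a ∸ 1) a

At′ : ℕ → Seq → ℕ
At′ n a with length a ≤? n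
... | yes _  = 0
... | no  p  = suc (lookup a (fromℕ< (≰⇒> p)))

-- least-number search μ n. p n > 0, given a witness of existence
-- (bounded search below the witness; returns the least such n)
μ-below : (ℕ → ℕ) → ℕ → ℕ
μ-below p zero = zero
μ-below p (suc k) with p 0
... | zero  = suc (μ-below (λ m → p (suc m)) k)
... | suc _ = zero

μ : (p : ℕ → ℕ) → ∃ (λ n → p n > 0) → ℕ
μ p (n , _) = μ-below p n

-- γ •′ α := γ(ᾱ(μ n. γ(ᾱn) > 0)) ∸ 1   (the search terminates by condition (i))
_•′[_]_ : (γ : Seq → ℕ) → IsNF γ → Baire → ℕ
γ •′[ nf ] α = γ (seg α (μ (λ n → γ (seg α n)) (proj₁ nf α))) ∸ 1

module Submission where

open import Defs
open import Data.Nat using (ℕ; zero; suc; _+_; _∸_; _≤_; _<_; _≤?_; _>_; z≤n; s≤s; s<s⁻¹)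
open import Data.Nat.Properties
  using (≰⇒>; ≤⇒≯; ≤-trans; m+n∸n≡m; +-identityʳ; m≤m+n; m≤n+m; n<1+n; m≤n⇒∃[o]m+o≡n)
open import Data.List using (List; _∷_; _++_; length; map; upTo; applyUpTo; lookup)
open import Data.List.Properties using (length-++; map-++; map-upTo; length-map; length-upTo; lookup-applyUpTo)
open import Data.Fin using (fromℕ<; toℕ)
open import Data.Fin.Properties using (toℕ-fromℕ<)
open import Data.Product using (_×_; _,_; proj₁; proj₂; ∃)
open import Data.Empty using (⊥-elim)
open import Function using (_∘_)
open import Relation.Binary.PropositionalEquality
open import Relation.Nullary using (yes; no)
open ≡-Reasoning

-- Everything rests on prefix stability: once γ(ᾱm) > 0, γ(ᾱn) has the same value
-- for every n ≥ m.  Hence KE′ h γ is decided at ᾱ(n+m) when γ decides j = g(α) at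
-- ᾱn and h j decides f j (α) at ᾱm; At′ n is decided at ᾱ(n+1); and •′ is correct
-- because the μ-search stops at a length where γ is positive.

PrefixStable : (Seq → ℕ) → Set
PrefixStable γ = ∀ a b → γ a > 0 → γ (a ++ b) ≡ γ a

applyUpTo-+ : ∀ {A : Set} (f : ℕ → A) m d → applyUpTo f (m + d) ≡ applyUpTo f m ++ applyUpTo (f ∘ (m +_)) d
applyUpTo-+ f zero    d = refl
applyUpTo-+ f (suc m) d = cong (f 0 ∷_) (applyUpTo-+ (f ∘ suc) m d)

seg-+ : ∀ α m d → seg α (m + d) ≡ seg α m ++ map α (applyUpTo (m +_) d)
seg-+ α m d = begin
  map α (upTo (m + d))                           ≡⟨ cong (map α) (applyUpTo-+ (λ i → i) m d) ⟩
  map α (upTo m ++ applyUpTo (m +_) d)           ≡⟨ map-++ α (upTo m) _ ⟩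
  seg α m ++ map α (applyUpTo (m +_) d)          ∎

length-seg : ∀ α m → length (seg α m) ≡ m
length-seg α m = trans (length-map α (upTo m)) (length-upTo m)

PrefixStable-seg : ∀ {γ} → PrefixStable γ → ∀ α {m n} → m ≤ n → γ (seg α m) > 0
                 → γ (seg α n) ≡ γ (seg α m)
PrefixStable-seg {γ} stable α {m} m≤n pos with m≤n⇒∃[o]m+o≡n m≤n
... | d , refl = begin
  γ (seg α (m + d))                            ≡⟨ cong γ (seg-+ α m d) ⟩
  γ (seg α m ++ map α (applyUpTo (m +_) d))    ≡⟨ stable (seg α m) _ pos ⟩
  γ (seg α m)                                  ∎

lookup-cong : ∀ {xs ys : List ℕ} {n} → xs ≡ ys → .(p : n < length xs) .(q : n < length ys)
            → lookup xs (fromℕ< p) ≡ lookup ys (fromℕ< q)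
lookup-cong refl _ _ = refl

lookup-seg : ∀ α m {n} (p : n < length (seg α m)) → lookup (seg α m) (fromℕ< p) ≡ α n
lookup-seg α m {n} p = begin
  lookup (seg α m) (fromℕ< p)           ≡⟨ lookup-cong (map-upTo α m) p q ⟩
  lookup (applyUpTo α m) (fromℕ< q)     ≡⟨ lookup-applyUpTo α m (fromℕ< q) ⟩
  α (toℕ (fromℕ< q))                    ≡⟨ cong α (toℕ-fromℕ< q) ⟩
  α n                                   ∎
  where
  q : n < length (applyUpTo α m)
  q = subst (n <_) (cong length (map-upTo α m)) p

lookup-++ˡ : ∀ (a b : List ℕ) {n} (p : n < length a) .(q : n < length (a ++ b))
           → lookup (a ++ b) (fromℕ< q) ≡ lookup a (fromℕ< p)
lookup-++ˡ (x ∷ a) b {zero}  p       q = refl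
lookup-++ˡ (x ∷ a) b {suc n} (s≤s p) q = lookup-++ˡ a b p (s<s⁻¹ q)

At′-lookup : ∀ n a → (p : n < length a) → At′ n a ≡ suc (lookup a (fromℕ< p))
At′-lookup n a p with length a ≤? n
... | yes a≤n = ⊥-elim (≤⇒≯ a≤n p)
... | no  _   = refl

At′-pos⇒< : ∀ n a → At′ n a > 0 → n < length a
At′-pos⇒< n a pos with length a ≤? n
... | no a≰n = ≰⇒> a≰n

At′-seg : ∀ n α m → At′ n (seg α m) > 0 → At′ n (seg α m) ≡ suc (α n)
At′-seg n α m pos = begin
  At′ n (seg α m)                          ≡⟨ At′-lookup n (seg α m) n<m ⟩
  suc (lookup (seg α m) (fromℕ< n<m))      ≡⟨ cong suc (lookup-seg α m n<m) ⟩
  suc (α n)                                ∎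
  where
  n<m : n < length (seg α m)
  n<m = At′-pos⇒< n (seg α m) pos

At′-isNFOf : ∀ n → IsNFOf (At′ n) (At n)
At′-isNFOf n = (covers , stable) , sound
  where
  covers : ∀ α → ∃ λ m → At′ n (seg α m) > 0
  covers α = suc n , subst (_> 0) (sym (At′-lookup n (seg α (suc n)) n<len)) (s≤s z≤n)
    where
    n<len : n < length (seg α (suc n))
    n<len = subst (n <_) (sym (length-seg α (suc n))) (n<1+n n)

  stable : PrefixStable (At′ n)
  stable a b pos = begin
    At′ n (a ++ b)                         ≡⟨ At′-lookup n (a ++ b) n<len++ ⟩
    suc (lookup (a ++ b) (fromℕ< n<len++)) ≡⟨ cong suc (lookup-++ˡ a b n<len n<len++) ⟩
    suc (lookup a (fromℕ< n<len))          ≡⟨ At′-lookup n a n<len ⟨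
    At′ n a                                ∎
    where
    n<len : n < length a
    n<len = At′-pos⇒< n a pos
    n<len++ : n < length (a ++ b)
    n<len++ = subst (n <_) (sym (length-++ a)) (≤-trans n<len (m≤m+n _ _))

  sound : ∀ α m → At′ n (seg α m) > 0 → At n α ≡ At′ n (seg α m) ∸ 1
  sound α m pos = sym (cong (_∸ 1) (At′-seg n α m pos))

η′-isNFOf : ∀ n → IsNFOf (η′ n) (η n)
η′-isNFOf n = ((λ α → 0 , m≤n+m 1 n) , λ a b _ → refl) , λ α m _ → sym (m+n∸n≡m n 1)

KE′-pos⇒ : ∀ h γ a → KE′ h γ a > 0 → γ a > 0
KE′-pos⇒ h γ a pos with γ a
... | suc _ = s≤s z≤n

KE′-of-pos : ∀ h γ a → γ a > 0 → KE′ h γ a ≡ h (γ a ∸ 1) a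
KE′-of-pos h γ a pos with γ a
... | suc j = +-identityʳ (h j a)

KE′-isNFOf : ∀ {h f γ g} → (∀ n → IsNFOf (h n) (f n)) → IsNFOf γ g → IsNFOf (KE′ h γ) (KE f g)
KE′-isNFOf {h} {f} {γ} {g} hf ((γ-covers , γ-stable) , γ-sound) = (covers , stable) , sound
  where
  covers : ∀ α → ∃ λ N → KE′ h γ (seg α N) > 0
  covers α = n + m , subst (_> 0) (sym KE′≡) h-pos
    where
    n : ℕ
    n = proj₁ (γ-covers α)
    γ-pos : γ (seg α n) > 0
    γ-pos = proj₂ (γ-covers α)
    j : ℕ
    j = γ (seg α n) ∸ 1
    m : ℕ
    m = proj₁ (proj₁ (proj₁ (hf j)) α)
    h-pos : h j (seg α m) > 0
    h-pos = proj₂ (proj₁ (proj₁ (hf j)) α)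
    γ≡ : γ (seg α (n + m)) ≡ γ (seg α n)
    γ≡ = PrefixStable-seg γ-stable α (m≤m+n n m) γ-pos
    KE′≡ : KE′ h γ (seg α (n + m)) ≡ h j (seg α m)
    KE′≡ = begin
      KE′ h γ (seg α (n + m))                    ≡⟨ KE′-of-pos h γ _ (subst (_> 0) (sym γ≡) γ-pos) ⟩
      h (γ (seg α (n + m)) ∸ 1) (seg α (n + m))  ≡⟨ cong (λ k → h (k ∸ 1) (seg α (n + m))) γ≡ ⟩
      h j (seg α (n + m))                        ≡⟨ PrefixStable-seg (proj₂ (proj₁ (hf j))) α (m≤n+m m n) h-pos ⟩
      h j (seg α m)                              ∎

  stable : PrefixStable (KE′ h γ)
  stable a b pos = begin
    KE′ h γ (a ++ b)               ≡⟨ KE′-of-pos h γ (a ++ b) (subst (_> 0) (sym γ≡) γ-pos) ⟩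
    h (γ (a ++ b) ∸ 1) (a ++ b)    ≡⟨ cong (λ k → h (k ∸ 1) (a ++ b)) γ≡ ⟩
    h (γ a ∸ 1) (a ++ b)           ≡⟨ proj₂ (proj₁ (hf (γ a ∸ 1))) a b (subst (_> 0) KE′≡ pos) ⟩
    h (γ a ∸ 1) a                  ≡⟨ KE′≡ ⟨
    KE′ h γ a                      ∎
    where
    γ-pos : γ a > 0
    γ-pos = KE′-pos⇒ h γ a pos
    γ≡ : γ (a ++ b) ≡ γ a
    γ≡ = γ-stable a b γ-pos
    KE′≡ : KE′ h γ a ≡ h (γ a ∸ 1) a
    KE′≡ = KE′-of-pos h γ a γ-pos

  sound : ∀ α n → KE′ h γ (seg α n) > 0 → KE f g α ≡ KE′ h γ (seg α n) ∸ 1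
  sound α n pos = begin
    f (g α) α                      ≡⟨ cong (λ k → f k α) (γ-sound α n γ-pos) ⟩
    f (γ s ∸ 1) α                  ≡⟨ proj₂ (hf (γ s ∸ 1)) α n (subst (_> 0) KE′≡ pos) ⟩
    h (γ s ∸ 1) s ∸ 1              ≡⟨ cong (_∸ 1) KE′≡ ⟨
    KE′ h γ s ∸ 1                  ∎
    where
    s : Seq
    s = seg α n
    γ-pos : γ s > 0
    γ-pos = KE′-pos⇒ h γ s pos
    KE′≡ : KE′ h γ s ≡ h (γ s ∸ 1) s
    KE′≡ = KE′-of-pos h γ s γ-pos

μ-below-pos : ∀ (p : ℕ → ℕ) n → p n > 0 → p (μ-below p n) > 0
μ-below-pos p zero    pos = pos
μ-below-pos p (suc n) pos with p 0 in p0
... | zero  = μ-below-pos (p ∘ suc) n pos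
... | suc _ = subst (_> 0) (sym p0) (s≤s z≤n)

•′-correct : ∀ {γ f} (nf : IsNFOf γ f) α → γ •′[ proj₁ nf ] α ≡ f • α
•′-correct {γ} ((covers , _) , sound) α =
  sym (sound α _ (μ-below-pos (γ ∘ seg α) (proj₁ (covers α)) (proj₂ (covers α))))

-- The continuity hypotheses are unused: a neighbourhood function already witnesses continuity.
lemma4p5 : (∀ (n : ℕ) → IsNFOf (η′ n) (η n) × IsNFOf (At′ n) (At n))
    × (∀ (h : ℕ → Seq → ℕ) (f : ℕ → Baire → ℕ) (γ : Seq → ℕ) (g : Baire → ℕ)
        → (∀ n → Continuous (f n)) → Continuous g
        → (∀ n → IsNFOf (h n) (f n)) → IsNFOf γ g
        → IsNFOf (KE′ h γ) (KE f g))
    × (∀ (γ : Seq → ℕ) (f : Baire → ℕ) → Continuous f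
        → (nf : IsNFOf γ f) → ∀ (α : Baire) → γ •′[ proj₁ nf ] α ≡ f • α)
lemma4p5 = (λ n → η′-isNFOf n , At′-isNFOf n)
         , (λ h f γ g _ _ → KE′-isNFOf)
         , (λ γ f _ → •′-correct)
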